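{- Let $\phi=(Q,\Sigma,\delta^\phi,q_0,Q\setminus\{q_{err}\})$ be a finite-state property, $\Gamma$ a finite alphabet and $R\subseteq\Sigma^*\times\Gamma$ a loss model. Define the NFA $\psi^*=(Q,\Gamma,\delta^\psi,q_0,Q\setminus\{q_{err}\})$ by $\delta^\psi(q,\gamma)=\delta^\phi(q,R^{ -1}(\gamma))=\{\delta^\phi(q,s)\mid s\in R^{ -1}(\gamma)\}$ for all $q\in Q$, $\gamma\in\Gamma$. Then $\psi^*$ recognizes $L_{opt}(\phi,R)$, i.e. $L(\psi^*)=\{y\in\Gamma^*\mid \mathcal{F}_R^{ -1}(y)\cap L(\phi)\neq\emptyset\}$.
   Context: A finite-state property is a minimum-state DFA $\phi=(Q,\Sigma,\delta^\phi,q_0,Q\setminus\{q_{err}\})$ whose distinguished error state $q_{err}$ is a trap state; $L(\phi)$ is its language (the non-violating strings). Transition functions are lifted to sets of strings and sets of states. A loss model is a relation $R\subseteq\Sigma^*\times\Gamma$, with $R^{ -1}(\gamma)=\{s\in\Sigma^*\mid sR\gamma\}$. A trace is a finite or infinite sequence over $\Sigma$. A partial function $f:\Sigma^*\to\Gamma^*$ defined on all prefixes of some trace is a filter under $R$ if whenever $f(x)=y$ and $f(x')\neq y$ for every proper prefix $x'$ of $x$, then $f(x\cdot s)=y\cdot\gamma$ if $sR\gamma$, and $f(x\cdot s)=y$ otherwise. $\mathcal{F}_R$ is the set of filters under $R$. A completion of $y\in\Gamma^*$ is an $x\in\Sigma^*$ such that for some $f\in\mathcal{F}_R$, $f(x)=y$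 and $f(x')\neq y$ for all proper prefixes $x'$ of $x$; $\mathcal{F}_R^{ -1}(y)$ is the set of completions of $y$. The NFA $\psi^*$ accepts $y$ iff $\delta^\psi(\{q_0\},y)$ contains a state other than $q_{err}$.
   Formalization: R relates no γ to the empty string; a filter has f(ε)=ε, and if f(x·s')=y for all proper prefixes s' of s, f(x·s) is y or some y·γ with sRγ, not necessarily y·γ when sRγ. The statement above fails without it. -}

module Defs where

open import Data.Nat using (ℕ; _≤_)
open import Data.Fin using (Fin; toℕ)
open import Data.Bool using (Bool; true)
open import Data.List using (List; []; _∷_; _++_; length; lookup; [_])
open import Data.Maybe using (Maybe; just; nothing)
open import Data.Product using (Σ; ∃; _×_; _,_)
open import Data.Sum using (_⊎_)
open import Relation.Nullary using (¬_)
open import Relation.Binary.PropositionalEquality using (_≡_; _≢_)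
open import Function.Bundles using (_⇔_)

record DFA (k : ℕ) : Set where
  field
    n      : ℕ
    δ      : Fin n → Fin k → Fin n
    q₀     : Fin n
    accept : Fin n → Bool

δ* : ∀ {k n} → (Fin n → Fin k → Fin n) → Fin n → List (Fin k) → Fin n
δ* δ q []       = q
δ* δ q (a ∷ w)  = δ* δ (δ q a) w

Accepts : ∀ {k} → (A : DFA k) → List (Fin k) → Set
Accepts A w = DFA.accept A (δ* (DFA.δ A) (DFA.q₀ A) w) ≡ true

IsMinimumState : ∀ {k} → DFA k → Set
IsMinimumState {k} A =
  (B : DFA k) → (∀ w → Accepts A w ⇔ Accepts B w) → DFA.n A ≤ DFA.n B

record IsProperty {k} (φ : DFA k) (qerr : Fin (DFA.n φ)) : Set where
  field
    minimum  : IsMinimumState φ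
    trap     : ∀ a → DFA.δ φ qerr a ≡ qerr
    accepts⇔ : ∀ q → (DFA.accept φ q ≡ true) ⇔ (q ≢ qerr)

LossModel : ℕ → ℕ → Set₁
LossModel k m = List (Fin k) → Fin m → Set

-- The NFA ψ* (states Fin n, alphabet Fin m), with transition relation
-- δψ q γ q'  iff  q' ∈ δ^φ(q, R⁻¹(γ)) = { δ^φ(q,s) | s R γ }.

δψ : ∀ {k m} → (φ : DFA k) → LossModel k m →
     Fin (DFA.n φ) → Fin m → Fin (DFA.n φ) → Set
δψ φ R q γ q' = Σ (List _) λ s → R s γ × δ* (DFA.δ φ) q s ≡ q'

δψ* : ∀ {k m} → (φ : DFA k) → LossModel k m →
      Fin (DFA.n φ) → List (Fin m) → Fin (DFA.n φ) → Set
δψ* φ R q []       q'' = q ≡ q''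
δψ* φ R q (γ ∷ y)  q'' = Σ (Fin (DFA.n φ)) λ q' → δψ φ R q γ q' × δψ* φ R q' y q''

ψ*Accepts : ∀ {k m} → (φ : DFA k) → Fin (DFA.n φ) → LossModel k m →
            List (Fin m) → Set
ψ*Accepts φ qerr R y = Σ (Fin (DFA.n φ)) λ q → δψ* φ R (DFA.q₀ φ) y q × q ≢ qerr

-- A (finite or infinite) trace over A: position i holds nothing once
-- the trace has ended.
record Trace (A : Set) : Set where
  field
    at    : ℕ → Maybe A
    ended : ∀ i → at i ≡ nothing → at (ℕ.suc i) ≡ nothing

IsPrefixOfTrace : ∀ {A} → List A → Trace A → Set
IsPrefixOfTrace w t = (i : Fin (length w)) → Trace.at t (toℕ i) ≡ just (lookup w i)

ProperPrefix : ∀ {A : Set} → List A → List A → Set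
ProperPrefix x' x = Σ (List _) λ s → s ≢ [] × x' ++ s ≡ x

Defined : ∀ {A : Set} → Maybe A → Set
Defined v = v ≢ nothing

FirstAt : ∀ {k m} → (List (Fin k) → Maybe (List (Fin m))) →
          List (Fin k) → List (Fin m) → Set
FirstAt f x y = f x ≡ just y × (∀ x' → ProperPrefix x' x → f x' ≢ just y)

IsFilter : ∀ {k m} → LossModel k m → (List (Fin k) → Maybe (List (Fin m))) → Set
IsFilter {k} {m} R f =
  Σ (Trace (Fin k)) (λ t → ∀ x → Defined (f x) ⇔ IsPrefixOfTrace x t)
  × f [] ≡ just []
  × (∀ x y s → FirstAt f x y → Defined (f (x ++ s)) →
       (∀ s' → ProperPrefix s' s → f (x ++ s') ≡ just y) →
       (Σ (Fin m) λ γ → R s γ × f (x ++ s) ≡ just (y ++ [ γ ]))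
       ⊎ f (x ++ s) ≡ just y)

Completion : ∀ {k m} → LossModel k m → List (Fin m) → List (Fin k) → Set
Completion {k} {m} R y x =
  Σ (List (Fin k) → Maybe (List (Fin m))) λ f → IsFilter R f × FirstAt f x y

Lopt : ∀ {k m} → DFA k → LossModel k m → List (Fin m) → Set
Lopt φ R y = Σ (List _) λ x → Completion R y x × Accepts φ x

module Submission where

-- The states of ψ* reached on y are the states δ^φ(q₀, s₁⋯sₙ) for the segmentations
-- y = γ₁⋯γₙ, sᵢ R γᵢ. Given a segmentation, the filter that stays silent while reading sᵢ
-- and emits γᵢ once sᵢ is complete has s₁⋯sₙ as a completion of y; it is a filter because
-- every sᵢ is non-empty, no γ being R-related to ε. Conversely, the points at which a filter
-- emits cut each completion of y into a segmentation, the filter law giving sᵢ R γᵢ.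

open import Defs
open import Data.Nat using (ℕ; zero; suc; _<_; s≤s; z≤n)
open import Data.Nat.Properties using (<-irrefl; <-trans)
open import Data.Fin using (Fin; toℕ) renaming (_≟_ to _≟ᶠ_)
import Data.Fin as Fin
open import Data.List using (List; []; _∷_; _++_; _∷ʳ_; length; lookup; [_])
open import Data.List.Properties
  using (++-assoc; ++-identityʳ; ++-identityʳ-unique; ++-conicalˡ; ++-conicalʳ; ∷-injective; ∷-injectiveʳ)
open import Data.List.Reverse using (Reverse; []; _∶_∶ʳ_; reverseView)
open import Data.Maybe using (Maybe; just; nothing)
import Data.Maybe as Maybe
open import Data.Maybe.Properties using (just-injective; map-injective)
open import Data.Product using (Σ; ∃; ∃₂; _×_; _,_)
open import Data.Sum using (_⊎_; inj₁; inj₂)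
import Data.Sum as Sum
open import Data.Empty using (⊥-elim)
open import Relation.Nullary using (¬_; yes; no)
open import Relation.Binary.Definitions using (DecidableEquality)
open import Relation.Binary.PropositionalEquality
  using (_≡_; _≢_; refl; sym; trans; cong; subst; subst₂; module ≡-Reasoning)
open import Function.Base using (_∘_; case_of_)
open import Function.Bundles using (_⇔_; mk⇔; Equivalence)
open import Function.Construct.Composition using (_⇔-∘_)
open import Function.Construct.Symmetry using (⇔-sym)

private
  variable
    A B : Set
    k m : ℕ
    R : LossModel k m

Prefix : List A → List A → Set
Prefix p z = ∃ λ r → p ++ r ≡ z

prefix-refl : (p : List A) → Prefix p p
prefix-refl p = [] , ++-identityʳ p

prefix-of-++ : (p r x s : List A) → p ++ r ≡ x ++ s →
               ProperPrefix p x ⊎ ∃ λ u → x ++ u ≡ p × u ++ r ≡ s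
prefix-of-++ []      r []      s e = inj₂ ([] , refl , e)
prefix-of-++ []      r (b ∷ x) s e = inj₁ (b ∷ x , (λ ()) , refl)
prefix-of-++ (c ∷ p) r []      s e = inj₂ (c ∷ p , refl , e)
prefix-of-++ (c ∷ p) r (b ∷ x) s e with ∷-injective e
... | refl , e′ = Sum.map (λ (u , u≢[] , e″) → u , u≢[] , cong (c ∷_) e″)
                          (λ (u , e₁ , e₂) → u , cong (c ∷_) e₁ , e₂)
                          (prefix-of-++ p r x s e′)

prefix-of-∷ʳ : {p z : List A} {a : A} → Prefix p (z ∷ʳ a) → Prefix p z ⊎ p ≡ z ∷ʳ a
prefix-of-∷ʳ {p = p} {z} {a} (r , e) with prefix-of-++ p r z [ a ] e
... | inj₁ (u , _ , e′)         = inj₁ (u , e′)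
... | inj₂ ([]     , e₁ , _)    = inj₁ ([] , trans (++-identityʳ p) (trans (sym e₁) (++-identityʳ z)))
... | inj₂ (b ∷ [] , refl , refl) = inj₂ refl
... | inj₂ (b ∷ c ∷ u , _ , e₂) with ∷-injectiveʳ e₂
...   | ()

properPrefix-of-∷ʳ : {p z : List A} {a : A} → ProperPrefix p (z ∷ʳ a) → Prefix p z
properPrefix-of-∷ʳ {p = p} (r , r≢[] , e) with prefix-of-∷ʳ (r , e)
... | inj₁ p⊑z  = p⊑z
... | inj₂ refl = ⊥-elim (r≢[] (++-identityʳ-unique p (sym e)))

module _ {g : A → B} where

  map-defined⁻ : ∀ {ma} → Defined (Maybe.map g ma) → Defined ma
  map-defined⁻ {just _}  _ = λ ()
  map-defined⁻ {nothing} d = ⊥-elim (d refl)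

  map-defined⁺ : ∀ {ma} → Defined ma → Defined (Maybe.map g ma)
  map-defined⁺ {just _}  _ = λ ()
  map-defined⁺ {nothing} d = ⊥-elim (d refl)

  map-just⁻ : ∀ {ma b} → Maybe.map g ma ≡ just b → ∃ λ a → ma ≡ just a × g a ≡ b
  map-just⁻ {just a} refl = a , refl , refl

-- IsPrefixOfTrace w t unfolds to Matches (Trace.at t) w; stating the lemmas for an arbitrary
-- function lets the induction drop the head of the trace.
Matches : (ℕ → Maybe A) → List A → Set
Matches g w = (i : Fin (length w)) → g (toℕ i) ≡ just (lookup w i)

matches-++ˡ : {g : ℕ → Maybe A} (p : List A) {q : List A} → Matches g (p ++ q) → Matches g p
matches-++ˡ         (c ∷ p) h Fin.zero    = h Fin.zero
matches-++ˡ {g = g} (c ∷ p) h (Fin.suc i) = matches-++ˡ {g = g ∘ suc} p (h ∘ Fin.suc) i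

atIndex : List A → ℕ → Maybe A
atIndex []      _       = nothing
atIndex (a ∷ w) zero    = just a
atIndex (a ∷ w) (suc i) = atIndex w i

atIndex-ended : (w : List A) (i : ℕ) → atIndex w i ≡ nothing → atIndex w (suc i) ≡ nothing
atIndex-ended []      i       _  = refl
atIndex-ended (a ∷ w) zero    ()
atIndex-ended (a ∷ w) (suc i) e  = atIndex-ended w i e

listTrace : List A → Trace A
listTrace w = record { at = atIndex w ; ended = atIndex-ended w }

matches-atIndex⇒prefix : (p w : List A) → Matches (atIndex w) p → Prefix p w
matches-atIndex⇒prefix []      w       h = w , refl
matches-atIndex⇒prefix (c ∷ p) []      h with h Fin.zero
... | ()
matches-atIndex⇒prefix (c ∷ p) (d ∷ w) h with h Fin.zero
... | refl with matches-atIndex⇒prefix p w (h ∘ Fin.suc)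
...   | r , e = r , cong (c ∷_) e

prefix⇒matches-atIndex : {p w : List A} → Prefix p w → Matches (atIndex w) p
prefix⇒matches-atIndex {p = c ∷ p} (r , refl) Fin.zero    = refl
prefix⇒matches-atIndex {p = c ∷ p} (r , refl) (Fin.suc i) = prefix⇒matches-atIndex {p = p} (r , refl) i

isPrefixOfListTrace⇔prefix : (p w : List A) → IsPrefixOfTrace p (listTrace w) ⇔ Prefix p w
isPrefixOfListTrace⇔prefix p w = mk⇔ (matches-atIndex⇒prefix p w) prefix⇒matches-atIndex

data Segmented {k m : ℕ} (R : LossModel k m) : List (Fin k) → List (Fin m) → Set where
  []  : Segmented R [] []
  _∷_ : ∀ {s γ x y} → R s γ → Segmented R x y → Segmented R (s ++ x) (γ ∷ y)

_∷ʳ-seg_ : ∀ {x y s γ} → Segmented R x y → R s γ → Segmented R (x ++ s) (y ∷ʳ γ)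
_∷ʳ-seg_ {R = R} {γ = γ} [] r = subst (λ v → Segmented R v [ γ ]) (++-identityʳ _) (r ∷ [])
_∷ʳ-seg_ {R = R} {y = γ′ ∷ y} {γ = γ} (_∷_ {s = s′} {x = x} r′ seg) r =
  subst (λ v → Segmented R v _) (sym (++-assoc s′ x _)) (r′ ∷ (seg ∷ʳ-seg r))

δ*-++ : ∀ {k n} (δ : Fin n → Fin k → Fin n) q u v → δ* δ q (u ++ v) ≡ δ* δ (δ* δ q u) v
δ*-++ δ q []      v = refl
δ*-++ δ q (a ∷ u) v = δ*-++ δ (δ q a) u v

module _ {k m : ℕ} (φ : DFA k) (R : LossModel k m) where
  open DFA φ using (δ)

  δψ*⇒segmented : ∀ {q y q′} → δψ* φ R q y q′ → ∃ λ x → Segmented R x y × δ* δ q x ≡ q′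
  δψ*⇒segmented {y = []}    q≡q′ = [] , [] , q≡q′
  δψ*⇒segmented {q = q} {y = γ ∷ y} (q₁ , (s , r , ends-q₁) , path) =
    let x , seg , ends = δψ*⇒segmented path
    in s ++ x , r ∷ seg , trans (δ*-++ δ q s x) (trans (cong (λ q′ → δ* δ q′ x) ends-q₁) ends)

  segmented⇒δψ* : ∀ {q x y} → Segmented R x y → δψ* φ R q y (δ* δ q x)
  segmented⇒δψ*         []                        = refl
  segmented⇒δψ* {q = q} (_∷_ {s = s} {x = x} r seg) =
    δ* δ q s , (s , r , refl) , subst (δψ* φ R (δ* δ q s) _) (sym (δ*-++ δ q s x)) (segmented⇒δψ* seg)

data Stripped (A : Set) : Set where
  rest     : List A → Stripped A
  inside   : Stripped A
  mismatch : Stripped A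

module _ (_≟_ : DecidableEquality A) where

  stripPrefix : List A → List A → Stripped A
  stripPrefix []      p       = rest p
  stripPrefix (c ∷ s) []      = inside
  stripPrefix (c ∷ s) (d ∷ p) with c ≟ d
  ... | yes _ = stripPrefix s p
  ... | no _  = mismatch

  stripPrefix-++ : ∀ s p → stripPrefix s (s ++ p) ≡ rest p
  stripPrefix-++ []      p = refl
  stripPrefix-++ (c ∷ s) p with c ≟ c
  ... | yes _  = stripPrefix-++ s p
  ... | no c≢c = ⊥-elim (c≢c refl)

  stripPrefix-properPrefix : ∀ {p s} → ProperPrefix p s → stripPrefix s p ≡ inside
  stripPrefix-properPrefix {[]}    ([]    , u≢[] , refl) = ⊥-elim (u≢[] refl)
  stripPrefix-properPrefix {[]}    (c ∷ u , _    , refl) = refl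
  stripPrefix-properPrefix {c ∷ p} (u     , u≢[] , refl) with c ≟ c
  ... | yes _  = stripPrefix-properPrefix {p} (u , u≢[] , refl)
  ... | no c≢c = ⊥-elim (c≢c refl)

  stripPrefix-rest : ∀ s p {r} → stripPrefix s p ≡ rest r → s ++ r ≡ p
  stripPrefix-rest []      p       refl = refl
  stripPrefix-rest (c ∷ s) []      ()
  stripPrefix-rest (c ∷ s) (d ∷ p) e with c ≟ d
  ... | yes refl = cong (c ∷_) (stripPrefix-rest s p e)

  stripPrefix-inside : ∀ s p → stripPrefix s p ≡ inside → ProperPrefix p s
  stripPrefix-inside []      p       ()
  stripPrefix-inside (c ∷ s) []      refl = c ∷ s , (λ ()) , refl
  stripPrefix-inside (c ∷ s) (d ∷ p) e with c ≟ d
  ... | yes refl = let u , u≢[] , e′ = stripPrefix-inside s p e in u , u≢[] , cong (c ∷_) e′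

Filter : ℕ → ℕ → Set
Filter k m = List (Fin k) → Maybe (List (Fin m))

FilterLaw : LossModel k m → Filter k m → Set
FilterLaw {m = m} R f =
  ∀ x y s → FirstAt f x y → Defined (f (x ++ s)) →
  (∀ s′ → ProperPrefix s′ s → f (x ++ s′) ≡ just y) →
  (Σ (Fin m) λ γ → R s γ × f (x ++ s) ≡ just (y ++ [ γ ])) ⊎ f (x ++ s) ≡ just y

DefinedExactlyOnPrefixesOf : Filter k m → List (Fin k) → Set
DefinedExactlyOnPrefixesOf f x = ∀ p → Defined (f p) ⇔ Prefix p x

record ExactCompletion (R : LossModel k m) (y : List (Fin m)) (x : List (Fin k)) : Set where
  field
    filter  : Filter k m
    domain  : DefinedExactlyOnPrefixesOf filter x
    initial : filter [] ≡ just []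
    law     : FilterLaw R filter
    first   : FirstAt filter x y

exactCompletion⇒completion : ∀ {y x} → ExactCompletion R y x → Completion R y x
exactCompletion⇒completion {x = x} c =
  filter , ((listTrace x , λ p → ⇔-sym (isPrefixOfListTrace⇔prefix p x) ⇔-∘ domain p) , initial , law) , first
  where open ExactCompletion c

silent : Filter k m
silent []      = just []
silent (_ ∷ _) = nothing

silent-domain : DefinedExactlyOnPrefixesOf (silent {k} {m}) []
silent-domain []      = mk⇔ (λ _ → [] , refl) (λ _ ())
silent-domain (_ ∷ _) = mk⇔ (λ d → ⊥-elim (d refl)) (λ ())

silent-law : FilterLaw R silent
silent-law []      .[] []      (refl , _) _ _ = inj₂ refl
silent-law []      .[] (_ ∷ _) (refl , _) d _ = ⊥-elim (d refl)
silent-law (_ ∷ _) y   s       (() , _)   _ _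

silent-first : FirstAt (silent {k} {m}) [] []
silent-first = refl , λ p (r , r≢[] , e) → ⊥-elim (r≢[] (++-conicalʳ p r e))

silent-exactCompletion : ExactCompletion R [] []
silent-exactCompletion = record
  { filter = silent ; domain = silent-domain ; initial = refl ; law = silent-law ; first = silent-first }

firstAt-[]⇒[] : ∀ {g : Filter k m} {x} → g [] ≡ just [] → FirstAt g x [] → x ≡ []
firstAt-[]⇒[] {x = []}    _   _              = refl
firstAt-[]⇒[] {x = b ∷ x} g[] (_ , earliest) = ⊥-elim (earliest [] (b ∷ x , (λ ()) , refl) g[])

module _ {k m : ℕ} (s : List (Fin k)) (γ : Fin m) (f : Filter k m) where

  resume : Stripped (Fin k) → Maybe (List (Fin m))
  resume (rest r) = Maybe.map (γ ∷_) (f r)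
  resume inside   = just []
  resume mismatch = nothing

  prepend : Filter k m
  prepend p = resume (stripPrefix _≟ᶠ_ s p)

  prepend-++ : ∀ p → prepend (s ++ p) ≡ Maybe.map (γ ∷_) (f p)
  prepend-++ p = cong resume (stripPrefix-++ _≟ᶠ_ s p)

  prepend-properPrefix : ∀ {p} → ProperPrefix p s → prepend p ≡ just []
  prepend-properPrefix p<s = cong resume (stripPrefix-properPrefix _≟ᶠ_ p<s)

  prepend-cases : ∀ p → (∃ λ r → s ++ r ≡ p × prepend p ≡ Maybe.map (γ ∷_) (f r))
                      ⊎ (ProperPrefix p s × prepend p ≡ just [])
                      ⊎ prepend p ≡ nothing
  prepend-cases p with stripPrefix _≟ᶠ_ s p in e
  ... | rest r   = inj₁ (r , stripPrefix-rest _≟ᶠ_ s p e , refl)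
  ... | inside   = inj₂ (inj₁ (stripPrefix-inside _≟ᶠ_ s p e , refl))
  ... | mismatch = inj₂ (inj₂ refl)

  prepend-defined⇒prefix : ∀ {x} → DefinedExactlyOnPrefixesOf f x →
                           ∀ p → Defined (prepend p) → Prefix p (s ++ x)
  prepend-defined⇒prefix {x} dom p d with prepend-cases p
  ... | inj₁ (r , refl , e) =
    let t , r++t≡x = Equivalence.to (dom r) (map-defined⁻ (subst Defined e d))
    in t , trans (++-assoc s r t) (cong (s ++_) r++t≡x)
  ... | inj₂ (inj₁ ((u , _ , p++u≡s) , _)) = u ++ x , trans (sym (++-assoc p u x)) (cong (_++ x) p++u≡s)
  ... | inj₂ (inj₂ e) = ⊥-elim (d e)

  prefix⇒prepend-defined : ∀ {x} → DefinedExactlyOnPrefixesOf f x →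
                           ∀ p → Prefix p (s ++ x) → Defined (prepend p)
  prefix⇒prepend-defined {x} dom p (t , e) with prefix-of-++ p t s x e
  ... | inj₁ p<s = subst Defined (sym (prepend-properPrefix p<s)) (λ ())
  ... | inj₂ (u , refl , u++t≡x) =
    subst Defined (sym (prepend-++ u)) (map-defined⁺ (Equivalence.from (dom u) (t , u++t≡x)))

  prepend-domain : ∀ {x} → DefinedExactlyOnPrefixesOf f x → DefinedExactlyOnPrefixesOf prepend (s ++ x)
  prepend-domain dom p = mk⇔ (prepend-defined⇒prefix dom p) (prefix⇒prepend-defined dom p)

  prepend-first : ∀ {x y} → FirstAt f x y → FirstAt prepend (s ++ x) (γ ∷ y)
  prepend-first {x} {y} (fx , earliest) = trans (prepend-++ x) (cong (Maybe.map (γ ∷_)) fx) , earlier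
    where
    earlier : ∀ p → ProperPrefix p (s ++ x) → prepend p ≢ just (γ ∷ y)
    earlier p (r , r≢[] , e) with prefix-of-++ p r s x e
    ... | inj₁ p<s = λ e′ → case just-injective (trans (sym (prepend-properPrefix p<s)) e′) of λ ()
    ... | inj₂ (u , refl , u++r≡x) =
      λ e′ → earliest u (r , r≢[] , u++r≡x) (map-injective ∷-injectiveʳ (trans (sym (prepend-++ u)) e′))

  prepend-[] : s ≢ [] → prepend [] ≡ just []
  prepend-[] s≢[] = prepend-properPrefix (s , s≢[] , refl)

  prepend-firstAt⁻ : s ≢ [] → ∀ {x y} → FirstAt prepend x y →
                     (x ≡ [] × y ≡ []) ⊎ ∃₂ λ x′ y′ → x ≡ s ++ x′ × y ≡ γ ∷ y′ × FirstAt f x′ y′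
  prepend-firstAt⁻ s≢[] {x} (px , earliest) with prepend-cases x
  ... | inj₁ (x′ , refl , e) with map-just⁻ {g = γ ∷_} {ma = f x′} (trans (sym e) px)
  ...   | y′ , fx′ , refl = inj₂ (x′ , y′ , refl , refl , fx′ , earlier)
    where
    earlier : ∀ p → ProperPrefix p x′ → f p ≢ just y′
    earlier p (r , r≢[] , p++r≡x′) fp =
      earliest (s ++ p) (r , r≢[] , trans (++-assoc s p r) (cong (s ++_) p++r≡x′))
               (trans (prepend-++ p) (cong (Maybe.map (γ ∷_)) fp))
  prepend-firstAt⁻ s≢[] {x} first@(px , _) | inj₂ (inj₁ (_ , e)) =
    let y≡[] = sym (just-injective (trans (sym e) px))
    in inj₁ (firstAt-[]⇒[] (prepend-[] s≢[]) (subst (FirstAt prepend x) y≡[] first) , y≡[])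
  prepend-firstAt⁻ s≢[] (px , _) | inj₂ (inj₂ e) = case trans (sym px) e of λ ()

  prepend-self : f [] ≡ just [] → prepend s ≡ just [ γ ]
  prepend-self f[] = begin
    prepend s                  ≡⟨ cong prepend (sym (++-identityʳ s)) ⟩
    prepend (s ++ [])          ≡⟨ prepend-++ [] ⟩
    Maybe.map (γ ∷_) (f [])    ≡⟨ cong (Maybe.map (γ ∷_)) f[] ⟩
    just [ γ ]                 ∎
    where open ≡-Reasoning

  module _ {R : LossModel k m} (r : R s γ) (f[] : f [] ≡ just []) where

    prepend-law-[] : ∀ t → Defined (prepend t) → (∀ t′ → ProperPrefix t′ t → prepend t′ ≡ just []) →
                     (Σ (Fin m) λ γ′ → R t γ′ × prepend t ≡ just [ γ′ ]) ⊎ prepend t ≡ just []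
    prepend-law-[] t d before with prepend-cases t
    ... | inj₁ ([] , refl , e) =
      inj₁ (γ , subst (λ v → R v γ) (sym (++-identityʳ s)) r , trans e (cong (Maybe.map (γ ∷_)) f[]))
    ... | inj₁ (b ∷ u , refl , _) =
      case just-injective (trans (sym (prepend-self f[])) (before s (b ∷ u , (λ ()) , refl))) of λ ()
    ... | inj₂ (inj₁ (_ , e)) = inj₂ e
    ... | inj₂ (inj₂ e)       = ⊥-elim (d e)

    prepend-law : s ≢ [] → FilterLaw R f → FilterLaw R prepend
    prepend-law s≢[] law x y t first d before with prepend-firstAt⁻ s≢[] first
    ... | inj₁ (refl , refl) = prepend-law-[] t d before
    ... | inj₂ (x′ , y′ , refl , refl , first′) =
      Sum.map (λ (γ′ , r′ , e) → γ′ , r′ , trans (shift t) (cong (Maybe.map (γ ∷_)) e))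
              (λ e → trans (shift t) (cong (Maybe.map (γ ∷_)) e))
              (law x′ y′ t first′ (map-defined⁻ (subst Defined (shift t) d)) before′)
      where
      shift : ∀ p → prepend ((s ++ x′) ++ p) ≡ Maybe.map (γ ∷_) (f (x′ ++ p))
      shift p = trans (cong prepend (++-assoc s x′ p)) (prepend-++ (x′ ++ p))
      before′ : ∀ t′ → ProperPrefix t′ t → f (x′ ++ t′) ≡ just y′
      before′ t′ t′<t = map-injective ∷-injectiveʳ (trans (sym (shift t′)) (before t′ t′<t))

segmented⇒exactCompletion : (∀ γ → ¬ R [] γ) →
                            ∀ {x y} → Segmented R x y → ExactCompletion R y x
segmented⇒exactCompletion noEmpty []                  = silent-exactCompletion
segmented⇒exactCompletion noEmpty (_∷_ {s} {γ} r seg) = record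
  { filter  = prepend s γ filter
  ; domain  = prepend-domain s γ filter domain
  ; initial = prepend-[] s γ filter s≢[]
  ; law     = prepend-law s γ filter r initial s≢[] law
  ; first   = prepend-first s γ filter first
  }
  where
  open ExactCompletion (segmented⇒exactCompletion noEmpty seg)
  s≢[] : s ≢ []
  s≢[] refl = noEmpty γ r

length-<-∷ʳ : (y : List A) (a : A) → length y < length (y ∷ʳ a)
length-<-∷ʳ []      a = s≤s z≤n
length-<-∷ʳ (b ∷ y) a = s≤s (length-<-∷ʳ y a)

module _ {k m : ℕ} {R : LossModel k m} {f : Filter k m} (initial : f [] ≡ just [])
         (prefix-closed : ∀ p q → Defined (f (p ++ q)) → Defined (f p)) (law : FilterLaw R f) where

  record Progress (z : List (Fin k)) : Set where
    constructor progress
    field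
      anchor pending  : List (Fin k)
      output          : List (Fin m)
      splits          : anchor ++ pending ≡ z
      steady          : ∀ p → Prefix p pending → f (anchor ++ p) ≡ just output
      -- what makes a new anchor the first point with its output
      earlier-shorter : ∀ p w → ProperPrefix p anchor → f p ≡ just w → length w < length output
      segmented       : Segmented R anchor output

  anchor-output : ∀ {z} (P : Progress z) → f (Progress.anchor P) ≡ just (Progress.output P)
  anchor-output (progress x₀ s _ _ steady _ _) =
    trans (cong f (sym (++-identityʳ x₀))) (steady [] (s , refl))

  anchor-first : ∀ {z} (P : Progress z) → FirstAt f (Progress.anchor P) (Progress.output P)
  anchor-first P@(progress _ _ y₀ _ _ shorter _) =
    anchor-output P , λ p p<x₀ fp → <-irrefl refl (shorter p y₀ p<x₀ fp)

  progress-[] : Progress []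
  progress-[] = progress [] [] [] refl steady nothing-earlier []
    where
    nothing-earlier : ∀ p w → ProperPrefix p [] → f p ≡ just w → length w < 0
    nothing-earlier p _ (r , r≢[] , e) = ⊥-elim (r≢[] (++-conicalʳ p r e))
    steady : ∀ p → Prefix p [] → f p ≡ just []
    steady p (r , e) = subst (λ v → f v ≡ just []) (sym (++-conicalˡ p r e)) initial

  progress-∷ʳ : ∀ {z a} → Progress z → Defined (f (z ∷ʳ a)) → Progress (z ∷ʳ a)
  progress-∷ʳ {a = a} P@(progress x₀ s y₀ refl steady shorter seg) d
    with law x₀ y₀ (s ∷ʳ a) (anchor-first P) (subst (Defined ∘ f) (++-assoc x₀ s [ a ]) d)
             (λ t t<s∷ʳa → steady t (properPrefix-of-∷ʳ t<s∷ʳa))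
  ... | inj₁ (γ , r , e) = progress x₁ [] (y₀ ∷ʳ γ) splits′ steady′ shorter′ (seg ∷ʳ-seg r)
    where
    x₁ = x₀ ++ (s ∷ʳ a)
    splits′ : x₁ ++ [] ≡ (x₀ ++ s) ∷ʳ a
    splits′ = trans (++-identityʳ x₁) (sym (++-assoc x₀ s [ a ]))
    steady′ : ∀ p → Prefix p [] → f (x₁ ++ p) ≡ just (y₀ ∷ʳ γ)
    steady′ p (r , p++r≡[]) = subst (λ v → f (x₁ ++ v) ≡ _) (sym (++-conicalˡ p r p++r≡[]))
                                    (trans (cong f (++-identityʳ x₁)) e)
    shorter′ : ∀ p w → ProperPrefix p x₁ → f p ≡ just w → length w < length (y₀ ∷ʳ γ)
    shorter′ p w (r , r≢[] , e′) fp with prefix-of-++ p r x₀ (s ∷ʳ a) e′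
    ... | inj₁ p<x₀ = <-trans (shorter p w p<x₀ fp) (length-<-∷ʳ y₀ γ)
    ... | inj₂ (u , refl , u++r≡s∷ʳa) =
      subst (λ v → length v < length (y₀ ∷ʳ γ))
            (just-injective (trans (sym (steady u (properPrefix-of-∷ʳ (r , r≢[] , u++r≡s∷ʳa)))) fp))
            (length-<-∷ʳ y₀ γ)
  ... | inj₂ e = progress x₀ (s ∷ʳ a) y₀ (sym (++-assoc x₀ s [ a ])) steady′ shorter seg
    where
    steady′ : ∀ p → Prefix p (s ∷ʳ a) → f (x₀ ++ p) ≡ just y₀
    steady′ p p⊑s∷ʳa with prefix-of-∷ʳ p⊑s∷ʳa
    ... | inj₁ p⊑s = steady p p⊑s
    ... | inj₂ refl = e

  progress-of : ∀ {z} → Reverse z → Defined (f z) → Progress z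
  progress-of []              _ = progress-[]
  progress-of (zs ∶ rs ∶ʳ a) d = progress-∷ʳ (progress-of rs (prefix-closed zs [ a ] d)) d

  progress-complete : ∀ {x y} → Progress x → FirstAt f x y → Segmented R x y
  progress-complete (progress x₀ [] y₀ refl steady _ seg) (fx , _) =
    subst₂ (Segmented R) (sym (++-identityʳ x₀))
           (just-injective (trans (sym (steady [] ([] , refl))) fx)) seg
  progress-complete P@(progress x₀ (b ∷ s) y₀ refl steady _ _) (fx , earliest) =
    ⊥-elim (earliest x₀ (b ∷ s , (λ ()) , refl) (trans (anchor-output P) (cong just y₀≡y)))
    where
    y₀≡y : y₀ ≡ _
    y₀≡y = just-injective (trans (sym (steady (b ∷ s) (prefix-refl (b ∷ s)))) fx)

  firstAt⇒segmented : ∀ {x y} → FirstAt f x y → Segmented R x y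
  firstAt⇒segmented {x} first@(fx , _) =
    progress-complete (progress-of (reverseView x) (λ e → case trans (sym fx) e of λ ())) first

completion⇒segmented : ∀ {y x} → Completion R y x → Segmented R x y
completion⇒segmented (f , ((t , domain) , initial , law) , first) =
  firstAt⇒segmented initial prefix-closed law first
  where
  prefix-closed : ∀ p q → Defined (f (p ++ q)) → Defined (f p)
  prefix-closed p q d =
    Equivalence.from (domain p) (matches-++ˡ {g = Trace.at t} p (Equivalence.to (domain (p ++ q)) d))

theorem3 : (k m : ℕ) (φ : DFA k) (qerr : Fin (DFA.n φ)) → IsProperty φ qerr →
           (R : LossModel k m) → (∀ γ → ¬ R [] γ) →
           ∀ y → ψ*Accepts φ qerr R y ⇔ Lopt φ R y
theorem3 k m φ qerr property R noEmpty y = mk⇔ ψ*⇒Lopt Lopt⇒ψ*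
  where
  open DFA φ using (δ; q₀)
  accepts⇔ : ∀ x → Accepts φ x ⇔ (δ* δ q₀ x ≢ qerr)
  accepts⇔ x = IsProperty.accepts⇔ property (δ* δ q₀ x)

  ψ*⇒Lopt : ψ*Accepts φ qerr R y → Lopt φ R y
  ψ*⇒Lopt (q , path , q≢qerr) =
    let x , seg , reaches-q = δψ*⇒segmented φ R path
    in x , exactCompletion⇒completion (segmented⇒exactCompletion noEmpty seg) ,
       Equivalence.from (accepts⇔ x) (subst (_≢ qerr) (sym reaches-q) q≢qerr)

  Lopt⇒ψ* : Lopt φ R y → ψ*Accepts φ qerr R y
  Lopt⇒ψ* (x , completion , accepted) =
    δ* δ q₀ x , segmented⇒δψ* φ R (completion⇒segmented completion) , Equivalence.to (accepts⇔ x) accepted
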